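{- Let $\mathcal{S}$ be a partial plane spread of size $16$ in $\mathrm{PG}(6,2)$ with hole set $N$, and let $n=\dim\langle N\rangle$. Then for every subspace $W$ of $\langle N\rangle$ of dimension $n-2$, the number $h(W)$ of holes in $W$ is odd.
   Context: A partial plane spread is a set of $3$-dimensional subspaces (blocks) of $\mathbb{F}_2^7$ pairwise intersecting in $\{0\}$; holes are the points ($1$-dimensional subspaces) not in any block (here there are $15$ holes); $h(X)$ denotes the number of holes in a point set $X$, subspaces being identified with their point sets. -}

module Defs where

open import Data.Bool using (Bool; true; false; not; _∧_; _∨_; _xor_)
open import Data.Nat using (ℕ; zero; suc; _^_)
open import Data.Fin using (Fin)
open import Data.Vec using (Vec; []; _∷_; replicate; zipWith)
open import Data.List using (List; []; _∷_; _++_; map; filter; length; allFin; concatMap)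
open import Data.Bool.ListAction using (any)
open import Data.Product using (_×_)
open import Relation.Binary.PropositionalEquality using (_≡_; _≢_)
open import Relation.Nullary.Decidable using (Dec)
open import Data.Bool.Properties using (T?)

-- Vectors of F₂^7, with F₂ represented by Bool (true = 1).
V : Set
V = Vec Bool 7

𝟎 : V
𝟎 = replicate 7 false

_⊕_ : V → V → V
_⊕_ = zipWith _xor_

allVecs : (k : ℕ) → List (Vec Bool k)
allVecs zero = [] ∷ []
allVecs (suc k) = concatMap (λ v → (false ∷ v) ∷ (true ∷ v) ∷ []) (allVecs k)

allV : List V
allV = allVecs 7

isNonzero : ∀ {k} → Vec Bool k → Bool
isNonzero [] = false
isNonzero (b ∷ v) = b ∨ isNonzero v

record Subspace : Set where
  field
    mem      : V → Bool
    mem-zero : mem 𝟎 ≡ true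
    mem-add  : ∀ u v → mem u ≡ true → mem v ≡ true → mem (u ⊕ v) ≡ true
open Subspace public

card : Subspace → ℕ
card W = length (filter (λ v → T? (mem W v)) allV)

HasDim : Subspace → ℕ → Set
HasDim W d = card W ≡ 2 ^ d

_⊆_ : Subspace → Subspace → Set
W ⊆ U = ∀ v → mem W v ≡ true → mem U v ≡ true

-- A partial plane spread of size 16 in PG(6,2): 16 planes (3-dim vector
-- subspaces of F₂^7) pairwise meeting only in {0}.
record PartialPlaneSpread16 : Set where
  field
    block     : Fin 16 → Subspace
    block-dim : ∀ i → HasDim (block i) 3
    disjoint  : ∀ i j → i ≢ j → ∀ v →
                mem (block i) v ≡ true → mem (block j) v ≡ true → v ≡ 𝟎
open PartialPlaneSpread16 public

covered : PartialPlaneSpread16 → V → Bool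
covered S v = any (λ i → mem (block S i) v) (allFin 16)

-- holes: points (nonzero vectors over F₂) not in any block
isHole : PartialPlaneSpread16 → V → Bool
isHole S v = isNonzero v ∧ not (covered S v)

h : PartialPlaneSpread16 → Subspace → ℕ
h S W = length (filter (λ v → T? (isHole S v ∧ mem W v)) allV)

IsHoleSpan : PartialPlaneSpread16 → Subspace → Set
IsHoleSpan S U =
  (∀ v → isHole S v ≡ true → mem U v ≡ true) ×
  (∀ X → (∀ v → isHole S v ≡ true → mem X v ≡ true) → U ⊆ X)

-- Since W has codimension 2 in U, there are two linear functionals
-- a, b with W = U ∩ ker a ∩ ker b.  As every hole lies in U, the holes of W
-- are exactly the holes of Y = ker a ∩ ker b, a subspace of F₂^7 of
-- codimension at most 2.  Y meets every plane of S in a subspace of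
-- dimension at least 1, and a nonzero subspace of F₂^k has an odd number of
-- nonzero vectors.  The nonzero vectors of Y are the holes in Y together with
-- the 16 pairwise disjoint sets of nonzero vectors on the blocks, so
--   h(Y) ≡ odd - 16 · odd ≡ 1 (mod 2).
module Submission where

open import Defs
open import Data.Bool using (Bool; true; false; not; _∧_; _xor_)
open import Data.Bool.Properties
  using ( T?; ∧-assoc; ∧-comm; ∧-identityʳ; ∧-zeroʳ; ∧-conicalˡ; ∧-conicalʳ
        ; ∧-distribˡ-xor; xor-assoc; xor-comm; xor-same; xor-identityʳ
        ; not-injective; not-involutive; xor-∧-commutativeRing )
open import Data.Bool.ListAction using (any)
open import Data.Fin using (Fin)
open import Data.List using (List; []; _∷_; map; filter; length; allFin; concatMap)
open import Data.List.Relation.Unary.All using (All; []; _∷_)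
open import Data.List.Relation.Unary.AllPairs using (AllPairs; []; _∷_)
open import Data.List.Relation.Unary.Unique.Propositional.Properties using (allFin⁺)
open import Data.Nat
  using (ℕ; zero; suc; _+_; _*_; _^_; _≤_; _<_; _%_; _≡ᵇ_; z≤n; s≤s; s≤s⁻¹; z<s; NonZero; >-nonZero; parity)
open import Data.Nat.Properties
open import Data.Nat.ListAction using (sum)
open import Data.Nat.Tactic.RingSolver using (solve-∀)
open import Data.Parity.Base as ℙ using (0ℙ; 1ℙ; _⁻¹)
import Data.Parity.Properties as ℙₚ
open import Data.Product using (_×_; _,_; ∃; ∃₂)
open import Data.Vec using (Vec; []; _∷_; replicate; zipWith)
open import Data.Empty using (⊥; ⊥-elim)
open import Relation.Nullary using (contradiction)
open import Relation.Binary.PropositionalEquality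
open import Algebra.Bundles using (CommutativeRing)
open import Algebra.Properties.CommutativeSemigroup +-commutativeSemigroup
  using () renaming (interchange to +-interchange)
open import Algebra.Properties.CommutativeSemigroup
  (CommutativeRing.+-commutativeSemigroup xor-∧-commutativeRing)
  using () renaming (interchange to xor-interchange)

-- (1) Sums and counts over F₂^k

χ : Bool → ℕ
χ true  = 1
χ false = 0

χ-∧ : ∀ a b → χ (a ∧ b) ≡ χ a * χ b
χ-∧ false b = refl
χ-∧ true  b = sym (+-identityʳ (χ b))

χ-split : ∀ a b → χ a ≡ χ (a ∧ not b) + χ (a ∧ b)
χ-split false b     = refl
χ-split true  false = refl
χ-split true  true  = refl

χ-pos : ∀ b → 0 < χ b → b ≡ true
χ-pos true _ = refl

χ≡0 : ∀ b → χ b ≡ 0 → b ≡ false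
χ≡0 false _ = refl

∑ : (k : ℕ) → (Vec Bool k → ℕ) → ℕ
∑ zero    f = f []
∑ (suc k) f = ∑ k (λ v → f (false ∷ v)) + ∑ k (λ v → f (true ∷ v))

∑-ext : ∀ k {f g : Vec Bool k → ℕ} → (∀ v → f v ≡ g v) → ∑ k f ≡ ∑ k g
∑-ext zero    f≗g = f≗g []
∑-ext (suc k) f≗g =
  cong₂ _+_ (∑-ext k (λ v → f≗g (false ∷ v))) (∑-ext k (λ v → f≗g (true ∷ v)))

∑-+ : ∀ k (f g : Vec Bool k → ℕ) → ∑ k (λ v → f v + g v) ≡ ∑ k f + ∑ k g
∑-+ zero    f g = refl
∑-+ (suc k) f g =
  trans (cong₂ _+_ (∑-+ k _ _) (∑-+ k _ _))
        (+-interchange (∑ k (λ v → f (false ∷ v))) (∑ k (λ v → g (false ∷ v)))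
                       (∑ k (λ v → f (true ∷ v)))  (∑ k (λ v → g (true ∷ v))))

∑-scale : ∀ k c (f : Vec Bool k → ℕ) → ∑ k (λ v → c * f v) ≡ c * ∑ k f
∑-scale zero    c f = refl
∑-scale (suc k) c f =
  trans (cong₂ _+_ (∑-scale k c _) (∑-scale k c _)) (sym (*-distribˡ-+ c _ _))

∑-const : ∀ k c → ∑ k (λ _ → c) ≡ c * 2 ^ k
∑-const zero    c = sym (*-identityʳ c)
∑-const (suc k) c = begin
  ∑ k (λ _ → c) + ∑ k (λ _ → c)   ≡⟨ cong₂ _+_ (∑-const k c) (∑-const k c) ⟩
  c * 2 ^ k + c * 2 ^ k           ≡⟨ *-distribˡ-+ c (2 ^ k) (2 ^ k) ⟨
  c * (2 ^ k + 2 ^ k)             ≡⟨ cong (λ t → c * (2 ^ k + t)) (+-identityʳ (2 ^ k)) ⟨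
  c * 2 ^ suc k                   ∎
  where open ≡-Reasoning

∑-swap : ∀ k l (f : Vec Bool k → Vec Bool l → ℕ) →
         ∑ k (λ u → ∑ l (f u)) ≡ ∑ l (λ v → ∑ k (λ u → f u v))
∑-swap zero    l f = refl
∑-swap (suc k) l f = trans (cong₂ _+_ (∑-swap k l _) (∑-swap k l _)) (sym (∑-+ l _ _))

∑-point : ∀ {k} (f : Vec Bool k → ℕ) v → f v ≤ ∑ k f
∑-point f []          = ≤-refl
∑-point f (false ∷ v) = ≤-trans (∑-point (λ u → f (false ∷ u)) v) (m≤m+n _ _)
∑-point f (true ∷ v)  = ≤-trans (∑-point (λ u → f (true ∷ u)) v) (m≤n+m _ _)

∑-witness : ∀ k (f : Vec Bool k → ℕ) → 0 < ∑ k f → ∃ λ v → 0 < f v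
∑-witness zero    f pos = [] , pos
∑-witness (suc k) f pos with ∑ k (λ v → f (false ∷ v)) in first
... | suc _ with v , fv>0 ← ∑-witness k _ (subst (0 <_) (sym first) z<s) = false ∷ v , fv>0
... | zero  with v , fv>0 ← ∑-witness k _ pos                             = true ∷ v , fv>0

infixl 6 _+ᵥ_
_+ᵥ_ : ∀ {k} → Vec Bool k → Vec Bool k → Vec Bool k
_+ᵥ_ = zipWith _xor_

+ᵥ-cancelʳ : ∀ {k} (v t : Vec Bool k) → (v +ᵥ t) +ᵥ t ≡ v
+ᵥ-cancelʳ []      []      = refl
+ᵥ-cancelʳ (a ∷ v) (b ∷ t) =
  cong₂ _∷_ (trans (xor-assoc a b b) (trans (cong (a xor_) (xor-same b)) (xor-identityʳ a)))
            (+ᵥ-cancelʳ v t)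

∑-translate : ∀ {k} (f : Vec Bool k → ℕ) t → ∑ k (λ v → f (v +ᵥ t)) ≡ ∑ k f
∑-translate f []          = refl
∑-translate f (false ∷ t) =
  cong₂ _+_ (∑-translate (λ u → f (false ∷ u)) t) (∑-translate (λ u → f (true ∷ u)) t)
∑-translate {suc k} f (true ∷ t) =
  trans (+-comm (∑ k (λ u → f (true ∷ (u +ᵥ t)))) (∑ k (λ u → f (false ∷ (u +ᵥ t)))))
  (cong₂ _+_ (∑-translate (λ u → f (false ∷ u)) t) (∑-translate (λ u → f (true ∷ u)) t))

Pred : ℕ → Set
Pred k = Vec Bool k → Bool

count : (k : ℕ) → Pred k → ℕ
count k P = ∑ k (λ v → χ (P v))

infixr 7 _∩_
_∩_ : ∀ {k} → Pred k → Pred k → Pred k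
(P ∩ R) v = P v ∧ R v

∁ : ∀ {k} → Pred k → Pred k
∁ P v = not (P v)

_⊑_ : ∀ {k} → Pred k → Pred k → Set
P ⊑ R = ∀ v → P v ≡ true → R v ≡ true

count-ext : ∀ k {P R : Pred k} → (∀ v → P v ≡ R v) → count k P ≡ count k R
count-ext k P≗R = ∑-ext k (λ v → cong χ (P≗R v))

count-split : ∀ k (Q P : Pred k) → count k Q ≡ count k (Q ∩ ∁ P) + count k (Q ∩ P)
count-split k Q P = trans (∑-ext k (λ v → χ-split (Q v) (P v))) (∑-+ k _ _)

count-pos : ∀ {k} {P : Pred k} v → P v ≡ true → 0 < count k P
count-pos {k} {P} v pv = subst (λ b → χ b ≤ count k P) pv (∑-point (λ u → χ (P u)) v)

count-witness : ∀ k {P : Pred k} → 0 < count k P → ∃ λ v → P v ≡ true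
count-witness k {P} pos with v , χ>0 ← ∑-witness k _ pos = v , χ-pos (P v) χ>0

count-≡0 : ∀ {k} (P : Pred k) → count k P ≡ 0 → ∀ v → P v ≡ false
count-≡0 P none v = χ≡0 (P v) (n≤0⇒n≡0 (subst (χ (P v) ≤_) none (∑-point (λ u → χ (P u)) v)))

count-empty : ∀ k {P : Pred k} → (∀ v → P v ≡ false) → count k P ≡ 0
count-empty k none = trans (∑-ext k (λ v → cong χ (none v))) (∑-const k 0)

count-<-witness : ∀ k {R T : Pred k} → count k T < count k R → ∃ λ v → R v ≡ true × T v ≡ false
count-<-witness k {R} {T} T<R =
  let v , outside = count-witness k outside>0
  in  v , ∧-conicalˡ _ _ outside , not-injective (∧-conicalʳ _ _ outside)
  where
  common≤T : count k (R ∩ T) ≤ count k T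
  common≤T = begin
    count k (R ∩ T)                       ≡⟨ count-ext k (λ v → ∧-comm (R v) (T v)) ⟩
    count k (T ∩ R)                       ≤⟨ m≤n+m _ _ ⟩
    count k (T ∩ ∁ R) + count k (T ∩ R)   ≡⟨ count-split k T R ⟨
    count k T                             ∎
    where open ≤-Reasoning
  outside>0 : 0 < count k (R ∩ ∁ T)
  outside>0 = n≢0⇒n>0 λ none →
    <-irrefl refl (<-≤-trans T<R
      (subst (_≤ count k T) (sym (trans (count-split k R T) (cong (_+ count k (R ∩ T)) none))) common≤T))

⊑-card : ∀ k {P R : Pred k} → P ⊑ R → count k R ≤ count k P → R ⊑ P
⊑-card k {P} {R} P⊑R R≤P v rv =
  not-injective (subst (λ r → r ∧ not (P v) ≡ false) rv (count-≡0 (R ∩ ∁ P) outside-empty v))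
  where
  common : ∀ v → (R ∩ P) v ≡ P v
  common v with P v in pv
  ... | true  = trans (∧-identityʳ (R v)) (P⊑R v pv)
  ... | false = ∧-zeroʳ (R v)
  outside-empty : count k (R ∩ ∁ P) ≡ 0
  outside-empty = n≤0⇒n≡0 (+-cancelʳ-≤ (count k P) _ 0
    (subst (_≤ count k P) (trans (count-split k R P) (cong (count k (R ∩ ∁ P) +_) (count-ext k common))) R≤P))

⊑-antisym : ∀ {k} {P R : Pred k} → P ⊑ R → R ⊑ P → ∀ v → P v ≡ R v
⊑-antisym {P = P} {R} P⊑R R⊑P v with P v in pv | R v in rv
... | true  | true  = refl
... | false | false = refl
... | true  | false = trans (sym (P⊑R v pv)) rv
... | false | true  = trans (sym pv) (R⊑P v rv)

sumL : ∀ {A : Set} → List A → (A → ℕ) → ℕ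
sumL xs f = sum (map f xs)

∑-sumL : ∀ k {A : Set} (xs : List A) (f : A → Vec Bool k → ℕ) →
         ∑ k (λ v → sumL xs (λ i → f i v)) ≡ sumL xs (λ i → ∑ k (f i))
∑-sumL k []       f = ∑-const k 0
∑-sumL k (x ∷ xs) f = trans (∑-+ k _ _) (cong (∑ k (f x) +_) (∑-sumL k xs f))

sumL-at-most-one : ∀ {A : Set} (xs : List A) → AllPairs _≢_ xs → (p : A → Bool) →
                   (∀ i j → i ≢ j → p i ≡ true → p j ≡ true → ⊥) →
                   sumL xs (λ i → χ (p i)) ≡ χ (any p xs)
sumL-at-most-one []       _                  p unique = refl
sumL-at-most-one (x ∷ xs) (x≢xs ∷ distinct) p unique with p x in px
... | false = sumL-at-most-one xs distinct p unique
... | true  = cong suc (silent x≢xs)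
  where
  silent : ∀ {ys} → All (x ≢_) ys → sumL ys (λ i → χ (p i)) ≡ 0
  silent []                 = refl
  silent {j ∷ _} (x≢j ∷ x≢ys) with p j in pj
  ... | false = silent x≢ys
  ... | true  = ⊥-elim (unique x j x≢j px pj)

-- (2) Linear algebra over F₂

0ᵥ : (k : ℕ) → Vec Bool k
0ᵥ k = replicate k false

infix 8 _·_
_·_ : ∀ {k} → Vec Bool k → Vec Bool k → Bool
[]      · []      = false
(a ∷ u) · (b ∷ v) = (a ∧ b) xor (u · v)

·-comm : ∀ {k} (u v : Vec Bool k) → u · v ≡ v · u
·-comm []      []      = refl
·-comm (a ∷ u) (b ∷ v) = cong₂ _xor_ (∧-comm a b) (·-comm u v)

·-0ˡ : ∀ {k} (v : Vec Bool k) → 0ᵥ k · v ≡ false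
·-0ˡ []      = refl
·-0ˡ (b ∷ v) = ·-0ˡ v

·-0ʳ : ∀ {k} (c : Vec Bool k) → c · 0ᵥ k ≡ false
·-0ʳ c = trans (·-comm c _) (·-0ˡ c)

·-+ʳ : ∀ {k} (c u v : Vec Bool k) → c · (u +ᵥ v) ≡ (c · u) xor (c · v)
·-+ʳ []      []      []      = refl
·-+ʳ (a ∷ c) (x ∷ u) (y ∷ v) = begin
  (a ∧ (x xor y)) xor c · (u +ᵥ v)                ≡⟨ cong₂ _xor_ (∧-distribˡ-xor a x y) (·-+ʳ c u v) ⟩
  ((a ∧ x) xor (a ∧ y)) xor (c · u xor c · v)     ≡⟨ xor-interchange (a ∧ x) (a ∧ y) (c · u) (c · v) ⟩
  ((a ∧ x) xor c · u) xor ((a ∧ y) xor c · v)     ∎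
  where open ≡-Reasoning

isNonzero-false : ∀ {k} (v : Vec Bool k) → isNonzero v ≡ false → v ≡ 0ᵥ k
isNonzero-false []          _ = refl
isNonzero-false (false ∷ v) z = cong (false ∷_) (isNonzero-false v z)

detect-nonzero : ∀ {k} (w : Vec Bool k) → isNonzero w ≡ true → ∃ λ c → c · w ≡ true
detect-nonzero (true ∷ w)  _  = true ∷ 0ᵥ _ , cong not (·-0ˡ w)
detect-nonzero (false ∷ w) nz with c , c·w ← detect-nonzero w nz = false ∷ c , c·w

record IsSubspace {k} (Q : Pred k) : Set where
  field
    0∈       : Q (0ᵥ k) ≡ true
    +-closed : ∀ u v → Q u ≡ true → Q v ≡ true → Q (u +ᵥ v) ≡ true
open IsSubspace

full : ∀ {k} → Pred k
full _ = true

ker : ∀ {k} → Vec Bool k → Pred k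
ker c = ∁ (c ·_)

full-subspace : ∀ {k} → IsSubspace {k} full
full-subspace = record { 0∈ = refl ; +-closed = λ _ _ _ _ → refl }

ker-subspace : ∀ {k} (c : Vec Bool k) → IsSubspace (ker c)
ker-subspace c = record
  { 0∈       = cong not (·-0ʳ c)
  ; +-closed = λ u v cu cv →
      cong not (trans (·-+ʳ c u v) (cong₂ _xor_ (not-injective cu) (not-injective cv)))
  }

∩-subspace : ∀ {k} {P R : Pred k} → IsSubspace P → IsSubspace R → IsSubspace (P ∩ R)
∩-subspace sP sR = record
  { 0∈       = cong₂ _∧_ (0∈ sP) (0∈ sR)
  ; +-closed = λ u v u∈ v∈ →
      cong₂ _∧_ (+-closed sP u v (∧-conicalˡ _ _ u∈) (∧-conicalˡ _ _ v∈))
                (+-closed sR u v (∧-conicalʳ _ _ u∈) (∧-conicalʳ _ _ v∈))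
  }

subspace : (W : Subspace) → IsSubspace (mem W)
subspace W = record { 0∈ = mem-zero W ; +-closed = mem-add W }

subspace-shift : ∀ {k} {Q : Pred k} → IsSubspace Q → ∀ {y} → Q y ≡ true → ∀ v → Q (v +ᵥ y) ≡ Q v
subspace-shift {Q = Q} sQ {y} qy v with Q v in qv | Q (v +ᵥ y) in qvy
... | true  | _     = trans (sym qvy) (+-closed sQ v y qv qy)
... | false | false = refl
... | false | true  =
  sym (trans (sym qv) (trans (cong Q (sym (+ᵥ-cancelʳ v y))) (+-closed sQ _ y qvy qy)))

zero-in : ∀ {k} {Q : Pred k} → IsSubspace Q → ∀ y → (Q ∩ ∁ isNonzero) y ≡ ∁ isNonzero y
zero-in {Q = Q} sQ y with isNonzero y in nz
... | true  = ∧-zeroʳ (Q y)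
... | false = trans (∧-identityʳ (Q y)) (subst (λ u → Q u ≡ true) (sym (isNonzero-false y nz)) (0∈ sQ))

zero-vector-count : ∀ k → count k (∁ isNonzero) ≡ 1
zero-vector-count zero    = refl
zero-vector-count (suc k) = cong₂ _+_ (zero-vector-count k) (∑-const k 0)

_^⊥ : ∀ {k} → Pred k → Pred k
(_^⊥ {k} Q) c = count k (Q ∩ (c ·_)) ≡ᵇ 0

^⊥-sound : ∀ {k} {Q : Pred k} {c} → (Q ^⊥) c ≡ true → ∀ y → Q y ≡ true → c · y ≡ false
^⊥-sound {k} {Q} {c} ann y qy with count k (Q ∩ (c ·_)) in none | ann
... | zero  | _ = trans (sym (cong (_∧ c · y) qy)) (count-≡0 _ none y)
... | suc _ | ()

^⊥-complete : ∀ {k} {Q : Pred k} {c} → (∀ y → Q y ≡ true → c · y ≡ false) → (Q ^⊥) c ≡ true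
^⊥-complete {k} {Q} {c} ann with count k (Q ∩ (c ·_)) in some
... | zero  = refl
... | suc _ = contradiction (trans (sym some) (count-empty k vanish)) λ ()
  where
  vanish : ∀ y → (Q ∩ (c ·_)) y ≡ false
  vanish y with Q y in qy
  ... | true  = ann y qy
  ... | false = refl

^⊥-witness : ∀ {k} {Q : Pred k} {c} → (Q ^⊥) c ≡ false → ∃ λ y → Q y ≡ true × c · y ≡ true
^⊥-witness {k} {Q} {c} notann with count k (Q ∩ (c ·_)) in some | notann
... | zero  | ()
... | suc _ | _ with y , both ← count-witness k (subst (0 <_) (sym some) z<s) =
  y , ∧-conicalˡ _ _ both , ∧-conicalʳ _ _ both

0∈^⊥ : ∀ {k} (Q : Pred k) → (Q ^⊥) (0ᵥ k) ≡ true
0∈^⊥ Q = ^⊥-complete {Q = Q} {c = 0ᵥ _} (λ y _ → ·-0ˡ y)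

full-annihilator : ∀ {k} (y : Vec Bool k) → (full ^⊥) y ≡ ∁ isNonzero y
full-annihilator y with isNonzero y in nz
... | false = ^⊥-complete {Q = full} {c = y}
                (λ c _ → subst (λ u → u · c ≡ false) (sym (isNonzero-false y nz)) (·-0ˡ c))
... | true with (full ^⊥) y in ann
...   | false = refl
...   | true  =
  let c , c·y = detect-nonzero y nz
  in  contradiction (trans (sym c·y) (trans (·-comm c y) (^⊥-sound {Q = full} {c = y} ann c refl))) λ ()

kernel-halves : ∀ {k} {Q : Pred k} → IsSubspace Q → ∀ {y c} → Q y ≡ true → c · y ≡ true →
                2 * count k (Q ∩ ker c) ≡ count k Q
kernel-halves {k} {Q} sQ {y} {c} qy cy = begin
  2 * K                      ≡⟨ cong (K +_) (+-identityʳ K) ⟩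
  K + K                      ≡⟨ cong (K +_) swapped ⟩
  K + count k (Q ∩ (c ·_))   ≡⟨ count-split k Q (c ·_) ⟨
  count k Q                  ∎
  where
  open ≡-Reasoning
  K = count k (Q ∩ ker c)
  -- translation by y swaps the kernel of c in Q with its complement in Q
  shifted : ∀ v → (Q ∩ ker c) (v +ᵥ y) ≡ (Q ∩ (c ·_)) v
  shifted v = trans
    (cong₂ (λ q d → q ∧ not d) (subspace-shift sQ qy v)
           (trans (·-+ʳ c v y) (trans (cong (c · v xor_) cy) (xor-comm (c · v) true))))
    (cong (Q v ∧_) (not-involutive (c · v)))
  swapped : K ≡ count k (Q ∩ (c ·_))
  swapped = trans (sym (∑-translate _ y)) (∑-ext k (λ v → cong χ (shifted v)))

kernel-of-annihilator : ∀ {k} {Q : Pred k} {c} → (Q ^⊥) c ≡ true → count k (Q ∩ ker c) ≡ count k Q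
kernel-of-annihilator {k} {Q} {c} ann = count-ext k kept
  where
  kept : ∀ v → (Q ∩ ker c) v ≡ Q v
  kept v with Q v in qv
  ... | true  = cong not (^⊥-sound {Q = Q} {c = c} ann v qv)
  ... | false = refl

kernel-count : ∀ {k} {Q : Pred k} → IsSubspace Q → ∀ c →
               2 * count k (Q ∩ ker c) ≡ count k Q + count k Q * χ ((Q ^⊥) c)
kernel-count {k} {Q} sQ c with (Q ^⊥) c in ann
... | true  = trans (cong (2 *_) (kernel-of-annihilator {Q = Q} {c = c} ann)) (double (count k Q))
  where
  double : ∀ n → 2 * n ≡ n + n * 1
  double = solve-∀
... | false with y , qy , cy ← ^⊥-witness {Q = Q} {c = c} ann =
  trans (kernel-halves sQ {y} {c} qy cy)
        (sym (trans (cong (count k Q +_) (*-zeroʳ (count k Q))) (+-identityʳ (count k Q))))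

kernel-lower : ∀ {k} {Q : Pred k} → IsSubspace Q → ∀ c → count k Q ≤ 2 * count k (Q ∩ ker c)
kernel-lower {k} {Q} sQ c = subst (count k Q ≤_) (sym (kernel-count sQ c)) (m≤m+n (count k Q) _)

-- (3) The product formula and codimension-2 subspaces

count-full : ∀ k → count k full ≡ 2 ^ k
count-full k = trans (∑-const k 1) (*-identityˡ (2 ^ k))

hyperplane-count : ∀ {k} (y : Vec Bool k) →
                   2 * count k (λ c → not (c · y)) ≡ 2 ^ k + 2 ^ k * χ (∁ isNonzero y)
hyperplane-count {k} y = begin
  2 * count k (λ c → not (c · y))          ≡⟨ cong (2 *_) (count-ext k (λ c → cong not (·-comm c y))) ⟩
  2 * count k (full ∩ ker y)               ≡⟨ kernel-count full-subspace y ⟩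
  count k full + count k full * χ ((full ^⊥) y)
    ≡⟨ cong₂ (λ n b → n + n * χ b) (count-full k) (full-annihilator y) ⟩
  2 ^ k + 2 ^ k * χ (∁ isNonzero y)        ∎
  where open ≡-Reasoning

-- |Q| · |Q^⊥| = 2^k, by counting pairs (c, y) ∈ F₂^k × Q with c · y = 0 in two ways.
annihilator-count : ∀ {k} {Q : Pred k} → IsSubspace Q → count k Q * count k (Q ^⊥) ≡ 2 ^ k
annihilator-count {k} {Q} sQ =
  +-cancelˡ-≡ (count k Q * 2 ^ k) _ _ (trans (sym by-functional) by-vector)
  where
  open ≡-Reasoning
  D = ∑ k (λ c → count k (Q ∩ ker c))
  by-functional : 2 * D ≡ count k Q * 2 ^ k + count k Q * count k (Q ^⊥)
  by-functional = begin
    2 * D                                                   ≡⟨ ∑-scale k 2 _ ⟨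
    ∑ k (λ c → 2 * count k (Q ∩ ker c))                     ≡⟨ ∑-ext k (kernel-count sQ) ⟩
    ∑ k (λ c → count k Q + count k Q * χ ((Q ^⊥) c))        ≡⟨ ∑-+ k _ _ ⟩
    ∑ k (λ _ → count k Q) + ∑ k (λ c → count k Q * χ ((Q ^⊥) c))
      ≡⟨ cong₂ _+_ (∑-const k _) (∑-scale k (count k Q) (λ c → χ ((Q ^⊥) c))) ⟩
    count k Q * 2 ^ k + count k Q * count k (Q ^⊥)          ∎
  -- the column of y contributes [y ∈ Q] · |y^⊥|
  column : ∀ y → 2 * ∑ k (λ c → χ (Q y ∧ not (c · y))) ≡ 2 ^ k * χ (Q y) + 2 ^ k * χ (∁ isNonzero y)
  column y = begin
    2 * ∑ k (λ c → χ (Q y ∧ not (c · y)))   ≡⟨ cong (2 *_) factor ⟩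
    2 * (q * N)                             ≡⟨ reassoc q N ⟩
    q * (2 * N)                             ≡⟨ cong (q *_) (hyperplane-count y) ⟩
    q * (2 ^ k + 2 ^ k * z)                 ≡⟨ distrib q (2 ^ k) z ⟩
    2 ^ k * q + 2 ^ k * (q * z)             ≡⟨ cong (λ t → 2 ^ k * q + 2 ^ k * t) 0∈Q ⟩
    2 ^ k * q + 2 ^ k * z                   ∎
    where
    q = χ (Q y)
    z = χ (∁ isNonzero y)
    N = count k (λ c → not (c · y))
    factor : ∑ k (λ c → χ (Q y ∧ not (c · y))) ≡ q * N
    factor = trans (∑-ext k (λ c → χ-∧ (Q y) _)) (∑-scale k q (λ c → χ (not (c · y))))
    0∈Q : q * z ≡ z
    0∈Q = trans (sym (χ-∧ (Q y) _)) (cong χ (zero-in sQ y))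
    reassoc : ∀ q N → 2 * (q * N) ≡ q * (2 * N)
    reassoc = solve-∀
    distrib : ∀ q p z → q * (p + p * z) ≡ p * q + p * (q * z)
    distrib = solve-∀
  by-vector : 2 * D ≡ count k Q * 2 ^ k + 2 ^ k
  by-vector = begin
    2 * D                                                    ≡⟨ cong (2 *_) (∑-swap k k _) ⟩
    2 * ∑ k (λ y → ∑ k (λ c → χ (Q y ∧ not (c · y))))        ≡⟨ ∑-scale k 2 _ ⟨
    ∑ k (λ y → 2 * ∑ k (λ c → χ (Q y ∧ not (c · y))))        ≡⟨ ∑-ext k column ⟩
    ∑ k (λ y → 2 ^ k * χ (Q y) + 2 ^ k * χ (∁ isNonzero y))  ≡⟨ ∑-+ k _ _ ⟩
    ∑ k (λ y → 2 ^ k * χ (Q y)) + ∑ k (λ y → 2 ^ k * χ (∁ isNonzero y))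
      ≡⟨ cong₂ _+_ (∑-scale k (2 ^ k) (λ y → χ (Q y))) (∑-scale k (2 ^ k) (λ y → χ (∁ isNonzero y))) ⟩
    2 ^ k * count k Q + 2 ^ k * count k (∁ isNonzero)
      ≡⟨ cong₂ _+_ (*-comm (2 ^ k) _) (trans (cong (2 ^ k *_) (zero-vector-count k)) (*-identityʳ _)) ⟩
    count k Q * 2 ^ k + 2 ^ k                                ∎

cross-< : ∀ {a b c d} → a * b ≡ c * d → a < c → 0 < d → d < b
cross-< {a} {b} {c} {d} ab≡cd a<c d>0 = ≰⇒> λ b≤d →
  <-irrefl ab≡cd (≤-<-trans (*-monoʳ-≤ a b≤d) (*-monoˡ-< d {{>-nonZero d>0}} a<c))

annihilator-< : ∀ {k} {W U : Pred k} → IsSubspace W → IsSubspace U →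
                count k W < count k U → count k (U ^⊥) < count k (W ^⊥)
annihilator-< {k} {W} {U} sW sU W<U =
  cross-< (trans (annihilator-count sW) (sym (annihilator-count sU))) W<U (count-pos {P = U ^⊥} (0ᵥ k) (0∈^⊥ U))

hyperplane-cut : ∀ {k} {W U : Pred k} → IsSubspace W → IsSubspace U → W ⊑ U → count k W < count k U →
                 ∃ λ a → W ⊑ (U ∩ ker a) × 2 * count k (U ∩ ker a) ≡ count k U
hyperplane-cut {k} {W} {U} sW sU W⊑U W<U
  with a , a∈W^⊥ , a∉U^⊥ ← count-<-witness k {R = W ^⊥} {T = U ^⊥} (annihilator-< sW sU W<U)
  with y , uy , ay ← ^⊥-witness {Q = U} {c = a} a∉U^⊥ =
  a , (λ v wv → cong₂ (λ u d → u ∧ not d) (W⊑U v wv) (^⊥-sound {Q = W} {c = a} a∈W^⊥ v wv))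
    , kernel-halves sU {y} {a} uy ay

ker₂ : ∀ {k} → Vec Bool k → Vec Bool k → Pred k
ker₂ a b = ker a ∩ ker b

codim-2 : ∀ {k} {W U : Pred k} → IsSubspace W → IsSubspace U → W ⊑ U →
          count k U ≡ count k W * 4 → ∃₂ λ a b → ∀ v → U v ≡ true → W v ≡ ker₂ a b v
codim-2 {k} {W} {U} sW sU W⊑U U≡4W =
  let a , W⊑U₁ , U₁-half = hyperplane-cut sW sU W⊑U (subst (w <_) (sym U≡4W) (m<m*n w 4 (s≤s (s≤s z≤n))))
      U₁≡2W              = *-cancelˡ-≡ _ _ 2 (trans U₁-half (trans U≡4W 4w≡2[2w]))
      b , W⊑U₂ , U₂-half = hyperplane-cut sW (∩-subspace sU (ker-subspace a)) W⊑U₁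
                             (subst (w <_) (sym U₁≡2W) (m<m*n w 2 (s≤s (s≤s z≤n))))
      U₂⊑W               = ⊑-card k W⊑U₂ (≤-reflexive
                             (*-cancelˡ-≡ _ _ 2 (trans U₂-half (trans U₁≡2W (*-comm w 2)))))
  in  a , b , λ v uv → trans (⊑-antisym W⊑U₂ U₂⊑W v) (cong (λ u → (u ∧ not (a · v)) ∧ not (b · v)) uv)
  where
  w = count k W
  instance
    w≢0 : NonZero w
    w≢0 = >-nonZero (count-pos {P = W} (0ᵥ k) (0∈ sW))
  4w≡2[2w] : w * 4 ≡ 2 * (w * 2)
  4w≡2[2w] = trans (sym (*-assoc w 2 2)) (*-comm (w * 2) 2)

ker₂-lower : ∀ {k} {Q : Pred k} → IsSubspace Q → ∀ a b → count k Q ≤ 2 * (2 * count k (Q ∩ ker₂ a b))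
ker₂-lower {k} {Q} sQ a b = begin
  count k Q                                 ≤⟨ kernel-lower sQ a ⟩
  2 * count k (Q ∩ ker a)                   ≤⟨ *-monoʳ-≤ 2 (kernel-lower (∩-subspace sQ (ker-subspace a)) b) ⟩
  2 * (2 * count k ((Q ∩ ker a) ∩ ker b))
    ≡⟨ cong (λ n → 2 * (2 * n)) (count-ext k (λ v → ∧-assoc (Q v) _ _)) ⟩
  2 * (2 * count k (Q ∩ ker₂ a b))          ∎
  where open ≤-Reasoning

-- (4) Parity

nonzero-count : ∀ {k} {Q : Pred k} → IsSubspace Q → count k Q ≡ suc (count k (Q ∩ isNonzero))
nonzero-count {k} {Q} sQ = begin
  count k Q                                             ≡⟨ count-split k Q isNonzero ⟩
  count k (Q ∩ ∁ isNonzero) + count k (Q ∩ isNonzero)   ≡⟨ cong (_+ count k (Q ∩ isNonzero)) only-0 ⟩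
  suc (count k (Q ∩ isNonzero))                         ∎
  where
  open ≡-Reasoning
  only-0 : count k (Q ∩ ∁ isNonzero) ≡ 1
  only-0 = trans (count-ext k (zero-in sQ)) (zero-vector-count k)

-- A subspace other than {0} has an odd number of nonzero vectors: it has an
-- even number of vectors, being halved by a functional detecting a nonzero one.
nonzero-odd : ∀ {k} {Q : Pred k} → IsSubspace Q → 2 ≤ count k Q → parity (count k (Q ∩ isNonzero)) ≡ 1ℙ
nonzero-odd {k} {Q} sQ Q≥2
  with w , qw ← count-witness k (s≤s⁻¹ (subst (2 ≤_) (nonzero-count sQ) Q≥2))
  with c , cw ← detect-nonzero w (∧-conicalʳ _ _ qw) =
  ℙₚ.⁻¹-injective (begin
    parity X ⁻¹                          ≡⟨ ℙₚ.+-homo-+ 1 X ⟨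
    parity (suc X)                       ≡⟨ cong parity (sym (nonzero-count sQ)) ⟩
    parity (count k Q)                   ≡⟨ cong parity (sym (kernel-halves sQ {w} {c} (∧-conicalˡ _ _ qw) cw)) ⟩
    parity (2 * count k (Q ∩ ker c))     ≡⟨ ℙₚ.*-homo-* 2 (count k (Q ∩ ker c)) ⟩
    0ℙ                                   ∎)
  where
  open ≡-Reasoning
  X = count k (Q ∩ isNonzero)

parity⇒%2 : ∀ n → parity n ≡ 1ℙ → n % 2 ≡ 1
parity⇒%2 (suc zero)    _   = refl
parity⇒%2 (suc (suc n)) odd = parity⇒%2 n odd

parity-sumL-odd : ∀ {A : Set} (xs : List A) (f : A → ℕ) → (∀ i → parity (f i) ≡ 1ℙ) →
                  parity (sumL xs f) ≡ parity (length xs)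
parity-sumL-odd []       f odd = refl
parity-sumL-odd (x ∷ xs) f odd = begin
  parity (f x + sumL xs f)              ≡⟨ ℙₚ.+-homo-+ (f x) _ ⟩
  parity (f x) ℙ.+ parity (sumL xs f)   ≡⟨ cong₂ ℙ._+_ (odd x) (parity-sumL-odd xs f odd) ⟩
  1ℙ ℙ.+ parity (length xs)             ≡⟨ ℙₚ.+-homo-+ 1 (length xs) ⟨
  parity (suc (length xs))              ∎
  where open ≡-Reasoning

-- (5) Holes of a partial plane spread in a subspace of F₂^7

sumL-doubled : ∀ {k} (xs : List (Vec Bool k)) (f : Vec Bool (suc k) → ℕ) →
               sumL (concatMap (λ v → (false ∷ v) ∷ (true ∷ v) ∷ []) xs) f
               ≡ sumL xs (λ v → f (false ∷ v)) + sumL xs (λ v → f (true ∷ v))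
sumL-doubled []       f = refl
sumL-doubled (x ∷ xs) f =
  trans (cong (λ t → f (false ∷ x) + (f (true ∷ x) + t)) (sumL-doubled xs f))
        (rearrange (f (false ∷ x)) (f (true ∷ x)) _ _)
  where
  rearrange : ∀ a b A B → a + (b + (A + B)) ≡ (a + A) + (b + B)
  rearrange = solve-∀

sumL-allVecs : ∀ k (f : Vec Bool k → ℕ) → sumL (allVecs k) f ≡ ∑ k f
sumL-allVecs zero    f = +-identityʳ (f [])
sumL-allVecs (suc k) f =
  trans (sumL-doubled (allVecs k) f) (cong₂ _+_ (sumL-allVecs k _) (sumL-allVecs k _))

length-filter : ∀ {A : Set} (xs : List A) (P : A → Bool) →
                length (filter (λ v → T? (P v)) xs) ≡ sumL xs (λ v → χ (P v))
length-filter []       P = refl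
length-filter (x ∷ xs) P with P x
... | true  = cong suc (length-filter xs P)
... | false = length-filter xs P

count-allV : (P : V → Bool) → length (filter (λ v → T? (P v)) allV) ≡ count 7 P
count-allV P = trans (length-filter allV P) (sumL-allVecs 7 (λ v → χ (P v)))

dim-count : ∀ (W : Subspace) d → HasDim W d → count 7 (mem W) ≡ 2 ^ d
dim-count W d dimW = trans (sym (count-allV (mem W))) dimW

blocks : List (Fin 16)
blocks = allFin 16

covering-number : ∀ S v → isNonzero v ≡ true →
                  sumL blocks (λ i → χ (mem (block S i) v)) ≡ χ (covered S v)
covering-number S v nz = sumL-at-most-one blocks (allFin⁺ 16) (λ i → mem (block S i) v)
  λ i j i≢j vi vj → nonzero≢𝟎 (subst (λ u → isNonzero u ≡ true) (disjoint S i j i≢j v vi vj) nz)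
  where
  nonzero≢𝟎 : isNonzero 𝟎 ≢ true
  nonzero≢𝟎 ()

hole-decomposition : ∀ S (Y : Pred 7) v →
  χ ((Y ∩ isNonzero) v)
  ≡ χ (Y v ∧ isHole S v) + sumL blocks (λ i → χ ((Y ∩ isNonzero) v ∧ mem (block S i) v))
hole-decomposition S Y v = begin
  χ x                                           ≡⟨ χ-split x (covered S v) ⟩
  χ (x ∧ not (covered S v)) + χ (x ∧ covered S v)
    ≡⟨ cong₂ _+_ (cong χ (∧-assoc (Y v) _ _)) (on-blocks x (∧-conicalʳ (Y v) _)) ⟩
  χ (Y v ∧ isHole S v) + sumL blocks (λ i → χ (x ∧ mem (block S i) v)) ∎
  where
  open ≡-Reasoning
  x = (Y ∩ isNonzero) v
  on-blocks : ∀ b → (b ≡ true → isNonzero v ≡ true) →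
              χ (b ∧ covered S v) ≡ sumL blocks (λ i → χ (b ∧ mem (block S i) v))
  on-blocks false _  = refl
  on-blocks true  nz = sym (covering-number S v (nz refl))

-- A subspace Y ≠ {0} meeting every block in a subspace ≠ {0} contains an odd
-- number of holes: its nonzero vectors (odd) are the holes plus 16 odd sets.
holes-odd : ∀ S {Y : Pred 7} → IsSubspace Y → 2 ≤ count 7 Y →
            (∀ i → 2 ≤ count 7 (mem (block S i) ∩ Y)) → parity (count 7 (λ v → Y v ∧ isHole S v)) ≡ 1ℙ
holes-odd S {Y} sY Y≥2 meets = begin
  parity H                    ≡⟨ ℙₚ.+-identityʳ (parity H) ⟨
  parity H ℙ.+ 0ℙ             ≡⟨ cong (parity H ℙ.+_) (parity-sumL-odd blocks onBlock block-odd) ⟨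
  parity H ℙ.+ parity T       ≡⟨ ℙₚ.+-homo-+ H T ⟨
  parity (H + T)              ≡⟨ cong parity decomposition ⟨
  parity (count 7 (Y ∩ isNonzero)) ≡⟨ nonzero-odd sY Y≥2 ⟩
  1ℙ                          ∎
  where
  open ≡-Reasoning
  H = count 7 (λ v → Y v ∧ isHole S v)
  onPoint : Fin 16 → V → ℕ
  onPoint i v = χ ((Y ∩ isNonzero) v ∧ mem (block S i) v)
  onBlock : Fin 16 → ℕ
  onBlock i = ∑ 7 (onPoint i)
  T = sumL blocks onBlock
  decomposition : count 7 (Y ∩ isNonzero) ≡ H + T
  decomposition = trans (∑-ext 7 (hole-decomposition S Y))
    (trans (∑-+ 7 (λ v → χ (Y v ∧ isHole S v)) (λ v → sumL blocks (λ i → onPoint i v)))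
           (cong (H +_) (∑-sumL 7 blocks onPoint)))
  block-odd : ∀ i → parity (onBlock i) ≡ 1ℙ
  block-odd i = trans (cong parity (count-ext 7 rearrange))
                      (nonzero-odd (∩-subspace {P = mem (block S i)} {R = Y} (subspace (block S i)) sY) (meets i))
    where
    rearrange : ∀ v → (Y v ∧ isNonzero v) ∧ mem (block S i) v ≡ ((mem (block S i) ∩ Y) ∩ isNonzero) v
    rearrange v = trans (∧-comm _ (mem (block S i) v)) (sym (∧-assoc (mem (block S i) v) _ _))

holes-in-ker₂-odd : ∀ S a b → parity (count 7 (λ v → ker₂ a b v ∧ isHole S v)) ≡ 1ℙ
holes-in-ker₂-odd S a b = holes-odd S (∩-subspace (ker-subspace a) (ker-subspace b))
  (at-least-2 (≤-trans (m≤m+n 8 120) (ker₂-lower full-subspace a b)))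
  λ i → at-least-2 (≤-trans (≤-reflexive (sym (dim-count (block S i) 3 (block-dim S i))))
                            (ker₂-lower (subspace (block S i)) a b))
  where
  at-least-2 : ∀ {x} → 8 ≤ 2 * (2 * x) → 2 ≤ x
  at-least-2 le = *-cancelˡ-≤ 2 (*-cancelˡ-≤ 2 le)

holes-via-ker₂ : ∀ S {U W : Subspace} → (∀ v → isHole S v ≡ true → mem U v ≡ true) →
                 ∀ a b → (∀ v → mem U v ≡ true → mem W v ≡ ker₂ a b v) →
                 h S W ≡ count 7 (λ v → ker₂ a b v ∧ isHole S v)
holes-via-ker₂ S {U} {W} holes⊆U a b W≡ker₂ =
  trans (count-allV (λ v → isHole S v ∧ mem W v)) (count-ext 7 same)
  where
  same : ∀ v → isHole S v ∧ mem W v ≡ ker₂ a b v ∧ isHole S v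
  same v with isHole S v in hole
  ... | true  = trans (W≡ker₂ v (holes⊆U v hole)) (sym (∧-identityʳ _))
  ... | false = sym (∧-zeroʳ _)

lemma4p5 : (S : PartialPlaneSpread16) (U : Subspace) → IsHoleSpan S U →
           (n : ℕ) → HasDim U n →
           (W : Subspace) → W ⊆ U → (m : ℕ) → HasDim W m → m + 2 ≡ n →
           h S W % 2 ≡ 1
lemma4p5 S U (holes⊆U , _) n dimU W W⊆U m dimW refl =
  let a , b , W≡ker₂ = codim-2 (subspace W) (subspace U) W⊆U index-4
  in  parity⇒%2 (h S W) (begin
        parity (h S W)                                     ≡⟨ cong parity (holes-via-ker₂ S {U} {W} holes⊆U a b W≡ker₂) ⟩
        parity (count 7 (λ v → ker₂ a b v ∧ isHole S v))   ≡⟨ holes-in-ker₂-odd S a b ⟩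
        1ℙ                                                 ∎)
  where
  open ≡-Reasoning
  index-4 : count 7 (mem U) ≡ count 7 (mem W) * 4
  index-4 = trans (dim-count U (m + 2) dimU)
                  (trans (^-distribˡ-+-* 2 m 2) (cong (_* 4) (sym (dim-count W m dimW))))
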